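{- Let $\rho$ be a graph parameter such that there exists a nondecreasing function $h$ with $\omega(G)\le h(\rho(G))$ for all graphs $G$. Let $g:\mathbb N\to\mathbb N$ be a nondecreasing function, let $c$ be an integer, and let $\mathcal G$ be a hereditary graph class such that there exists a nondecreasing function $f:\mathbb N\to\mathbb N$ with $\mu_{\rho,c}(G)\le f(\omega(G))\cdot g(|V(G)|)$ for all $G\in\mathcal G$. Then for every graph $G\in\mathcal G$, every minimum $(\rho,c)$-modulator $S$ of $G$ satisfies $\alpha(G[S])\le f(h(c)+1)\cdot g(|V(G)|)$.
   Context: All graphs are finite, simple and undirected; $\alpha,\omega$ denote independence and clique number; $\mathbb N$ is the set of positive integers. A graph parameter is an integer-valued isomorphism-invariant function on graphs. A hereditary graph class is a set of graphs closed under isomorphism and induced subgraphs. For a graph parameter $\rho$, an integer $c$ and a graph $G$, a set $S\subseteq V(G)$ is a $(\rho,c)$-modulator if $\rho(G-S)\le c$; $\mu_{\rho,c}(G)$ is the minimum cardinality of a $(\rho,c)$-modulator of $G$, and a minimum $(\rho,c)$-modulator is one of this cardinality. -}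

module Defs where

open import Data.Bool using (Bool; true; false; _∧_; _∨_; not; if_then_else_)
open import Data.Nat using (ℕ; zero; suc; _⊔_; _≤_; _+_; _*_)
open import Data.Integer as ℤ using (ℤ)
open import Data.Fin using (Fin; _≟_)
open import Data.Fin.Subset using (Subset; _∈_; ∁; ∣_∣)
open import Data.Fin.Subset.Properties using (_∈?_)
open import Data.List using (List; []; _∷_; _++_; map; filter; length; lookup; foldr; allFin)
open import Data.Vec as Vec using (Vec; []; _∷_)
open import Relation.Nullary using (does)
open import Relation.Binary.PropositionalEquality using (_≡_)
open import Function.Bundles using (_↔_; Inverse)
open import Data.Product using (_×_)

record Graph : Set where
  field
    n      : ℕ
    adj    : Fin n → Fin n → Bool
    sym    : ∀ i j → adj i j ≡ adj j i
    irrefl : ∀ i → adj i i ≡ false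
open Graph public

∣V∣ : Graph → ℕ
∣V∣ G = n G

verts : ∀ {m} → Subset m → List (Fin m)
verts {m} S = filter (_∈? S) (allFin m)

induced : (G : Graph) → Subset (n G) → Graph
induced G S = record
  { n      = length (verts S)
  ; adj    = λ i j → adj G (lookup (verts S) i) (lookup (verts S) j)
  ; sym    = λ i j → sym G (lookup (verts S) i) (lookup (verts S) j)
  ; irrefl = λ i → irrefl G (lookup (verts S) i)
  }

_─V_ : (G : Graph) → Subset (n G) → Graph
G ─V S = induced G (∁ S)

record Iso (G H : Graph) : Set where
  field
    bij      : Fin (n G) ↔ Fin (n H)
    preserve : ∀ i j → adj G i j ≡ adj H (Inverse.to bij i) (Inverse.to bij j)

allSubsets : (m : ℕ) → List (Subset m)
allSubsets zero    = [] ∷ []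
allSubsets (suc m) = map (true ∷_) (allSubsets m) ++ map (false ∷_) (allSubsets m)

allB : ∀ {A : Set} → (A → Bool) → List A → Bool
allB p []       = true
allB p (x ∷ xs) = p x ∧ allB p xs

pairs : ∀ {m} → (Fin m → Fin m → Bool) → Bool
pairs {m} p = allB (λ i → allB (λ j → p i j) (allFin m)) (allFin m)

isIndependent : (G : Graph) → Subset (n G) → Bool
isIndependent G S = pairs (λ i j → not (Vec.lookup S i ∧ Vec.lookup S j ∧ adj G i j))

isClique : (G : Graph) → Subset (n G) → Bool
isClique G S =
  pairs (λ i j → not (Vec.lookup S i ∧ Vec.lookup S j ∧ not (does (i ≟ j))) ∨ adj G i j)

maxList : List ℕ → ℕ
maxList = foldr _⊔_ 0

α : Graph → ℕ
α G = maxList (map (λ S → if isIndependent G S then ∣ S ∣ else 0) (allSubsets (n G)))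

ω : Graph → ℕ
ω G = maxList (map (λ S → if isClique G S then ∣ S ∣ else 0) (allSubsets (n G)))

IsGraphParameter : (Graph → ℤ) → Set
IsGraphParameter ρ = ∀ G H → Iso G H → ρ G ≡ ρ H

IsHereditary : (Graph → Set) → Set
IsHereditary 𝒢 = (∀ G H → Iso G H → 𝒢 G → 𝒢 H)
               × (∀ G (S : Subset (n G)) → 𝒢 G → 𝒢 (induced G S))

IsModulator : (Graph → ℤ) → ℤ → (G : Graph) → Subset (n G) → Set
IsModulator ρ c G S = ρ (G ─V S) ℤ.≤ c

IsMinModulator : (Graph → ℤ) → ℤ → (G : Graph) → Subset (n G) → Set
IsMinModulator ρ c G S =
  IsModulator ρ c G S × (∀ T → IsModulator ρ c G T → ∣ S ∣ ≤ ∣ T ∣)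

-- "μ_{ρ,c}(G) ≤ b": the minimum cardinality of a (ρ,c)-modulator is ≤ b,
-- i.e. every minimum (ρ,c)-modulator has cardinality ≤ b.
μ≤ : (Graph → ℤ) → ℤ → Graph → ℕ → Set
μ≤ ρ c G b = ∀ S → IsMinModulator ρ c G S → ∣ S ∣ ≤ b

Nondecreasing : (ℕ → ℕ) → Set
Nondecreasing f = ∀ {x y} → x ≤ y → f x ≤ f y

NondecreasingZ : (ℤ → ℕ) → Set
NondecreasingZ h = ∀ {x y} → x ℤ.≤ y → h x ≤ h y

-- Let S be a minimum (ρ,c)-modulator of G and I an independent set of G[S]. In
-- G′ = G − (S ∖ I) the set I is a modulator with G′ − I = G − S, and a minimum one:
-- a modulator T of G′ gives the modulator T ∪ (S ∖ I) of G, so |S| ≤ |T| + |S ∖ I|,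
-- i.e. |I| ≤ |T|. As I is independent, ω(G′) ≤ ω(G′ − I) + 1 ≤ h(ρ(G − S)) + 1 ≤ h(c) + 1,
-- and the hypothesis applied to G′ ∈ 𝒢 bounds |I| by f(h(c) + 1) · g(|V(G)|).

module Submission where

open import Data.Bool using (Bool; true; false; not; _∧_; _∨_; if_then_else_)
open import Data.Bool.Properties using (not-injective)
open import Data.Fin using (Fin; zero; suc; _≟_)
open import Data.Fin.Properties using (injective⇒≤; any?)
open import Data.Fin.Subset using (Subset; inside; outside; _∈_; _∉_; _⊆_; ∁; _∪_; _∩_; ∣_∣; ⊤)
open import Data.Fin.Subset.Properties
  using (_∈?_; ∣p∣≤n; p⊆q⇒∣p∣≤∣q∣; ⊆-antisym; drop-∷-⊆; x∈∁p⇒x∉p; x∉∁p⇒x∈p; x∉p⇒x∈∁p;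
         x∈p∪q⁺; x∈p∪q⁻; q⊆p∪q; x∈p∩q⁺; x∈p∩q⁻; p∩q⊆q)
open import Data.List as List using (List; []; _∷_; length; filter; tabulate; allFin)
import Data.List.Membership.Propositional as List
open import Data.List.Membership.Propositional.Properties
  using (∈-filter⁺; ∈-filter⁻; ∈-allFin; ∈-lookup; ∈-map⁺; ∈-++⁺ˡ; ∈-++⁺ʳ)
open import Data.List.Relation.Unary.All as All using (All; []; _∷_)
open import Data.List.Relation.Unary.All.Properties using (tabulate⁺; tabulate⁻)
open import Data.List.Relation.Unary.Any as Any using (here; there)
open import Data.List.Relation.Unary.Any.Properties using (lookup-index)
open import Data.List.Relation.Unary.AllPairs using ([]; _∷_)
open import Data.List.Relation.Unary.Unique.Propositional using (Unique)
open import Data.List.Relation.Unary.Unique.Propositional.Properties as Unique using ()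
open import Data.Integer as ℤ using (ℤ)
open import Data.Nat using (ℕ; zero; suc; _≤_; _+_; _*_; z≤n; s≤s)
open import Data.Nat.Properties
  using (+-suc; +-comm; ≤-trans; ≤-antisym; ⊔-lub; m≤m⊔n; m≤n⊔m; +-mono-≤; +-cancelˡ-≤; *-mono-≤; module ≤-Reasoning)
open import Data.Product using (∃; _×_; _,_; proj₁; proj₂)
open import Data.Sum using (inj₁; inj₂)
open import Data.Vec as Vec using (_∷_; []; here; there)
open import Data.Vec.Properties using (lookup∘tabulate; []=⇒lookup; lookup⇒[]=)
open import Function using (id; _∘_; case_of_)
open import Function.Bundles using (mk↔ₛ′)
open import Function.Definitions using (Injective)
open import Relation.Binary.PropositionalEquality
  using (_≡_; _≢_; refl; sym; trans; cong; cong₂; subst; subst₂; module ≡-Reasoning)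
open import Relation.Nullary using (does; yes; no; contradiction)
open import Relation.Nullary.Decidable using (_×-dec_; dec-true; dec-false)

open import Defs hiding (sym)

private
  variable
    m k : ℕ

∣p∪q∣≡∣p∣+∣q∣ : {p q : Subset m} → (∀ {x} → x ∈ p → x ∉ q) → ∣ p ∪ q ∣ ≡ ∣ p ∣ + ∣ q ∣
∣p∪q∣≡∣p∣+∣q∣ {p = []}          {[]}          _        = refl
∣p∪q∣≡∣p∣+∣q∣ {p = inside ∷ p}  {inside ∷ q}  disjoint = contradiction here (disjoint here)
∣p∪q∣≡∣p∣+∣q∣ {p = inside ∷ p}  {outside ∷ q} disjoint =
  cong suc (∣p∪q∣≡∣p∣+∣q∣ λ x∈p x∈q → disjoint (there x∈p) (there x∈q))
∣p∪q∣≡∣p∣+∣q∣ {p = outside ∷ p} {inside ∷ q}  disjoint =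
  trans (cong suc (∣p∪q∣≡∣p∣+∣q∣ λ x∈p x∈q → disjoint (there x∈p) (there x∈q))) (sym (+-suc _ _))
∣p∪q∣≡∣p∣+∣q∣ {p = outside ∷ p} {outside ∷ q} disjoint =
  ∣p∪q∣≡∣p∣+∣q∣ λ x∈p x∈q → disjoint (there x∈p) (there x∈q)

∁[∁p∪q]∪q≡p : {p q : Subset m} → q ⊆ p → ∁ (∁ p ∪ q) ∪ q ≡ p
∁[∁p∪q]∪q≡p {p = []}          {[]}          _   = refl
∁[∁p∪q]∪q≡p {p = inside ∷ p}  {inside ∷ q}  q⊆p = cong (inside ∷_) (∁[∁p∪q]∪q≡p (drop-∷-⊆ q⊆p))
∁[∁p∪q]∪q≡p {p = inside ∷ p}  {outside ∷ q} q⊆p = cong (inside ∷_) (∁[∁p∪q]∪q≡p (drop-∷-⊆ q⊆p))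
∁[∁p∪q]∪q≡p {p = outside ∷ p} {inside ∷ q}  q⊆p with () ← q⊆p here
∁[∁p∪q]∪q≡p {p = outside ∷ p} {outside ∷ q} q⊆p = cong (outside ∷_) (∁[∁p∪q]∪q≡p (drop-∷-⊆ q⊆p))

length-filter-shift : ∀ s (p : Subset m) (f : Fin k → Fin m) →
  length (filter (_∈? (s ∷ p)) (tabulate (suc ∘ f))) ≡ length (filter (_∈? p) (tabulate f))
length-filter-shift {k = zero}  s p f = refl
length-filter-shift {k = suc k} s p f with does (f zero ∈? p)
... | true  = cong suc (length-filter-shift s p (f ∘ suc))
... | false = length-filter-shift s p (f ∘ suc)

∣verts∣≡∣p∣ : (p : Subset m) → length (verts p) ≡ ∣ p ∣
∣verts∣≡∣p∣ []            = refl
∣verts∣≡∣p∣ (inside ∷ p)  = cong suc (trans (length-filter-shift inside p id) (∣verts∣≡∣p∣ p))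
∣verts∣≡∣p∣ (outside ∷ p) = trans (length-filter-shift outside p id) (∣verts∣≡∣p∣ p)

Unique⇒lookup-injective : ∀ {A : Set} {xs : List A} → Unique xs → Injective _≡_ _≡_ (List.lookup xs)
Unique⇒lookup-injective (_ ∷ _) {zero} {zero} _ = refl
Unique⇒lookup-injective (x∉xs ∷ _) {zero} {suc j} eq = contradiction eq (All.lookup x∉xs (∈-lookup j))
Unique⇒lookup-injective (x∉xs ∷ _) {suc i} {zero} eq = contradiction (sym eq) (All.lookup x∉xs (∈-lookup i))
Unique⇒lookup-injective (_ ∷ u) {suc i} {suc j} eq = cong suc (Unique⇒lookup-injective u eq)

ι : (p : Subset m) → Fin (length (verts p)) → Fin m
ι p = List.lookup (verts p)

ι∈ : (p : Subset m) (i : Fin (length (verts p))) → ι p i ∈ p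
ι∈ {m} p i = proj₂ (∈-filter⁻ (_∈? p) {xs = allFin m} (∈-lookup i))

ι-injective : (p : Subset m) → Injective _≡_ _≡_ (ι p)
ι-injective {m} p = Unique⇒lookup-injective (Unique.filter⁺ (_∈? p) (Unique.allFin⁺ m))

ι-onto : (p : Subset m) {x : Fin m} → x ∈ p → ∃ λ i → ι p i ≡ x
ι-onto p x∈p = Any.index x∈verts , sym (lookup-index x∈verts)
  where x∈verts = ∈-filter⁺ (_∈? p) (∈-allFin _) x∈p

injective⇒∣p∣≤∣q∣ : ∀ {m′} {p : Subset m} {q : Subset m′} (φ : ∀ {x} → x ∈ p → Fin m′) →
  (∀ {x} (x∈p : x ∈ p) → φ x∈p ∈ q) →
  (∀ {x y} (x∈p : x ∈ p) (y∈p : y ∈ p) → φ x∈p ≡ φ y∈p → x ≡ y) →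
  ∣ p ∣ ≤ ∣ q ∣
injective⇒∣p∣≤∣q∣ {p = p} {q} φ φ∈q φ-injective =
  subst₂ _≤_ (∣verts∣≡∣p∣ p) (∣verts∣≡∣p∣ q) (injective⇒≤ ψ-injective)
  where
  ψ : Fin (length (verts p)) → Fin (length (verts q))
  ψ i = proj₁ (ι-onto q (φ∈q (ι∈ p i)))
  ψ-injective : Injective _≡_ _≡_ ψ
  ψ-injective {i} {j} eq = ι-injective p (φ-injective (ι∈ p i) (ι∈ p j) (begin
    φ (ι∈ p i)     ≡⟨ proj₂ (ι-onto q (φ∈q (ι∈ p i))) ⟨
    ι q (ψ i)      ≡⟨ cong (ι q) eq ⟩
    ι q (ψ j)      ≡⟨ proj₂ (ι-onto q (φ∈q (ι∈ p j))) ⟩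
    φ (ι∈ p j)     ∎))
    where open ≡-Reasoning

∈tabulate⁺ : {g : Fin m → Bool} {x : Fin m} → g x ≡ true → x ∈ Vec.tabulate g
∈tabulate⁺ {g = g} {x} gx = lookup⇒[]= x _ (trans (lookup∘tabulate g x) gx)

∈tabulate⁻ : {g : Fin m → Bool} {x : Fin m} → x ∈ Vec.tabulate g → g x ≡ true
∈tabulate⁻ {g = g} {x} x∈ = trans (sym (lookup∘tabulate g x)) ([]=⇒lookup x∈)

-- Opaque, so that f and p are recovered from the type  x ∈ image f p  by unification.
opaque
  image : (Fin k → Fin m) → Subset k → Subset m
  image f p = Vec.tabulate λ x → does (any? λ i → i ∈? p ×-dec f i ≟ x)

  ∈image⁺ : {f : Fin k → Fin m} {p : Subset k} {i : Fin k} → i ∈ p → f i ∈ image f p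
  ∈image⁺ {f = f} {p} {i} i∈p = ∈tabulate⁺ (dec-true (any? λ j → j ∈? p ×-dec f j ≟ f i) (i , i∈p , refl))

  ∈image⁻ : {f : Fin k → Fin m} {p : Subset k} {x : Fin m} → x ∈ image f p → ∃ λ i → i ∈ p × f i ≡ x
  ∈image⁻ {f = f} {p} {x} x∈ with any? (λ i → i ∈? p ×-dec f i ≟ x) | ∈tabulate⁻ x∈
  ... | yes witness | _ = witness

opaque
  preimage : (Fin k → Fin m) → Subset m → Subset k
  preimage f q = Vec.tabulate λ i → Vec.lookup q (f i)

  ∈preimage⁺ : {f : Fin k → Fin m} {q : Subset m} {i : Fin k} → f i ∈ q → i ∈ preimage f q
  ∈preimage⁺ fi∈q = ∈tabulate⁺ ([]=⇒lookup fi∈q)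

  ∈preimage⁻ : {f : Fin k → Fin m} {q : Subset m} {i : Fin k} → i ∈ preimage f q → f i ∈ q
  ∈preimage⁻ {f = f} {q} {i} i∈ = lookup⇒[]= (f i) q (∈tabulate⁻ i∈)

∣image∣≡∣p∣ : {f : Fin k → Fin m} → Injective _≡_ _≡_ f → (p : Subset k) → ∣ image f p ∣ ≡ ∣ p ∣
∣image∣≡∣p∣ {f = f} f-injective p = ≤-antisym
  (injective⇒∣p∣≤∣q∣ (proj₁ ∘ ∈image⁻) (proj₁ ∘ proj₂ ∘ ∈image⁻) witness-injective)
  (injective⇒∣p∣≤∣q∣ (λ {i} _ → f i) ∈image⁺ (λ _ _ → f-injective))
  where
  witness-injective : ∀ {x y} (x∈ : x ∈ image f p) (y∈ : y ∈ image f p) →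
                      proj₁ (∈image⁻ x∈) ≡ proj₁ (∈image⁻ y∈) → x ≡ y
  witness-injective x∈ y∈ eq with ∈image⁻ x∈ | ∈image⁻ y∈
  witness-injective _ _ refl | _ , _ , refl | _ , _ , refl = refl

image-ι-preimage : {p q : Subset m} → q ⊆ p → image (ι p) (preimage (ι p) q) ≡ q
image-ι-preimage {p = p} {q} q⊆p = ⊆-antisym image⊆q q⊆image
  where
  image⊆q : image (ι p) (preimage (ι p) q) ⊆ q
  image⊆q x∈ with ∈image⁻ x∈
  ... | _ , i∈ , refl = ∈preimage⁻ i∈
  q⊆image : q ⊆ image (ι p) (preimage (ι p) q)
  q⊆image x∈q with ι-onto p (q⊆p x∈q)
  ... | _ , refl = ∈image⁺ (∈preimage⁺ x∈q)

∣preimage-ι∣≡∣q∣ : {p q : Subset m} → q ⊆ p → ∣ preimage (ι p) q ∣ ≡ ∣ q ∣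
∣preimage-ι∣≡∣q∣ {p = p} q⊆p = trans (sym (∣image∣≡∣p∣ (ι-injective p) _)) (cong ∣_∣ (image-ι-preimage q⊆p))

lift : (p : Subset m) → Subset (length (verts p)) → Subset m
lift p b = ∁ p ∪ image (ι p) b

module _ (p : Subset m) (b : Subset (length (verts p))) where

  ∣lift∣≡∣∁p∣+∣b∣ : ∣ lift p b ∣ ≡ ∣ ∁ p ∣ + ∣ b ∣
  ∣lift∣≡∣∁p∣+∣b∣ = trans (∣p∪q∣≡∣p∣+∣q∣ disjoint) (cong (∣ ∁ p ∣ +_) (∣image∣≡∣p∣ (ι-injective p) b))
    where
    disjoint : ∀ {x} → x ∈ ∁ p → x ∉ image (ι p) b
    disjoint x∈∁p x∈image with ∈image⁻ x∈image
    ... | i , _ , refl = x∈∁p⇒x∉p x∈∁p (ι∈ p i)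

  ι∘ι∈∁lift : ∀ j → ι p (ι (∁ b) j) ∈ ∁ (lift p b)
  ι∘ι∈∁lift j = x∉p⇒x∈∁p λ x∈lift → case x∈p∪q⁻ (∁ p) _ x∈lift of λ where
    (inj₁ x∈∁p)    → x∈∁p⇒x∉p x∈∁p (ι∈ p _)
    (inj₂ x∈image) → let i , i∈b , eq = ∈image⁻ x∈image in
      x∈∁p⇒x∉p (subst (_∈ ∁ b) (sym (ι-injective p eq)) (ι∈ (∁ b) j)) i∈b

  ∈∁lift⁻ : ∀ {x} → x ∈ ∁ (lift p b) → ∃ λ j → ι p (ι (∁ b) j) ≡ x
  ∈∁lift⁻ x∈ with ι-onto p (x∉∁p⇒x∈p (x∈∁p⇒x∉p x∈ ∘ x∈p∪q⁺ ∘ inj₁))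
  ... | i , refl with ι-onto (∁ b) (x∉p⇒x∈∁p (x∈∁p⇒x∉p x∈ ∘ x∈p∪q⁺ ∘ inj₂ ∘ ∈image⁺))
  ...   | j , refl = j , refl

embedding-iso : (G H : Graph) (c : Subset (n G)) (φ : Fin (n H) → Fin (n G)) →
  Injective _≡_ _≡_ φ → (∀ i j → adj H i j ≡ adj G (φ i) (φ j)) →
  (∀ i → φ i ∈ c) → (∀ {x} → x ∈ c → ∃ λ i → φ i ≡ x) →
  Iso H (induced G c)
embedding-iso G H c φ φ-injective φ-adj φ∈c φ-onto = record
  { bij      = mk↔ₛ′ to from to∘from from∘to
  ; preserve = λ i j → trans (φ-adj i j) (sym (cong₂ (adj G) (ι-to i) (ι-to j)))
  }
  where
  to : Fin (n H) → Fin (length (verts c))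
  to i = proj₁ (ι-onto c (φ∈c i))
  ι-to : ∀ i → ι c (to i) ≡ φ i
  ι-to i = proj₂ (ι-onto c (φ∈c i))
  from : Fin (length (verts c)) → Fin (n H)
  from k = proj₁ (φ-onto (ι∈ c k))
  φ-from : ∀ k → φ (from k) ≡ ι c k
  φ-from k = proj₂ (φ-onto (ι∈ c k))
  to∘from : ∀ k → to (from k) ≡ k
  to∘from k = ι-injective c (trans (ι-to (from k)) (φ-from k))
  from∘to : ∀ i → from (to i) ≡ i
  from∘to i = φ-injective (trans (φ-from (to i)) (ι-to i))

induced-─V-lift : (G : Graph) (p : Subset (n G)) (b : Subset (length (verts p))) →
  Iso (induced G p ─V b) (G ─V lift p b)
induced-─V-lift G p b = embedding-iso G (induced G p ─V b) (∁ (lift p b)) (ι p ∘ ι (∁ b))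
  (ι-injective (∁ b) ∘ ι-injective p) (λ _ _ → refl) (ι∘ι∈∁lift p b) (∈∁lift⁻ p b)

Independent : (G : Graph) → Subset (n G) → Set
Independent G s = ∀ {i j} → i ∈ s → j ∈ s → adj G i j ≡ false

Clique : (G : Graph) → Subset (n G) → Set
Clique G s = ∀ {i j} → i ∈ s → j ∈ s → i ≢ j → adj G i j ≡ true

module _ (G : Graph) (p : Subset (n G)) where

  Independent-image : {s : Subset (length (verts p))} →
                      Independent (induced G p) s → Independent G (image (ι p) s)
  Independent-image s-independent i∈ j∈ with ∈image⁻ i∈ | ∈image⁻ j∈
  ... | _ , i′∈s , refl | _ , j′∈s , refl = s-independent i′∈s j′∈s

  Independent-preimage : {s : Subset (n G)} → Independent G s → Independent (induced G p) (preimage (ι p) s)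
  Independent-preimage s-independent i∈ j∈ = s-independent (∈preimage⁻ i∈) (∈preimage⁻ j∈)

  Clique-preimage : {s : Subset (n G)} → Clique G s → Clique (induced G p) (preimage (ι p) s)
  Clique-preimage s-clique i∈ j∈ i≢j = s-clique (∈preimage⁻ i∈) (∈preimage⁻ j∈) (i≢j ∘ ι-injective p)

Clique∩Independent⇒∣∣≤1 : (G : Graph) {k s : Subset (n G)} → Clique G k → Independent G s → ∣ k ∩ s ∣ ≤ 1
Clique∩Independent⇒∣∣≤1 G {k} {s} k-clique s-independent =
  injective⇒∣p∣≤∣q∣ {q = ⊤ {1}} (λ _ → zero) (λ _ → here) equal
  where
  equal : ∀ {x y} → x ∈ k ∩ s → y ∈ k ∩ s → zero ≡ zero → x ≡ y
  equal {x} {y} x∈ y∈ _ with x ≟ y | x∈p∩q⁻ k s x∈ | x∈p∩q⁻ k s y∈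
  ... | yes x≡y | _ | _ = x≡y
  ... | no x≢y | x∈k , x∈s | y∈k , y∈s =
    contradiction (trans (sym (k-clique x∈k y∈k x≢y)) (s-independent x∈s y∈s)) λ ()

allB⇒All : ∀ {A : Set} {P : A → Bool} (xs : List A) → allB P xs ≡ true → All (λ x → P x ≡ true) xs
allB⇒All []                _  = []
allB⇒All {P = P} (x ∷ xs) ok with P x in Px
... | true = Px ∷ allB⇒All xs ok

All⇒allB : ∀ {A : Set} {P : A → Bool} {xs : List A} → All (λ x → P x ≡ true) xs → allB P xs ≡ true
All⇒allB []         = refl
All⇒allB (Px ∷ Pxs) rewrite Px = All⇒allB Pxs

pairs⇒ : {P : Fin m → Fin m → Bool} → pairs P ≡ true → ∀ i j → P i j ≡ true
pairs⇒ {m} ok i j = tabulate⁻ (allB⇒All (allFin m) (tabulate⁻ (allB⇒All (allFin m) ok) i)) j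

pairs⇐ : {P : Fin m → Fin m → Bool} → (∀ i j → P i j ≡ true) → pairs P ≡ true
pairs⇐ all = All⇒allB (tabulate⁺ λ i → All⇒allB (tabulate⁺ (all i)))

module _ {G : Graph} {s : Subset (n G)} where

  isIndependent⇒Independent : isIndependent G s ≡ true → Independent G s
  isIndependent⇒Independent ok {i} {j} i∈s j∈s with pairs⇒ ok i j
  ... | nonadjacent rewrite []=⇒lookup i∈s | []=⇒lookup j∈s = not-injective nonadjacent

  isClique⇒Clique : isClique G s ≡ true → Clique G s
  isClique⇒Clique ok {i} {j} i∈s j∈s i≢j with pairs⇒ ok i j
  ... | adjacent rewrite []=⇒lookup i∈s | []=⇒lookup j∈s | dec-false (i ≟ j) i≢j = adjacent

  Clique⇒isClique : Clique G s → isClique G s ≡ true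
  Clique⇒isClique s-clique = pairs⇐ adjacent
    where
    adjacent : ∀ i j → (not (Vec.lookup s i ∧ Vec.lookup s j ∧ not (does (i ≟ j))) ∨ adj G i j) ≡ true
    adjacent i j with Vec.lookup s i in i∈s | Vec.lookup s j in j∈s | i ≟ j
    ... | true  | true  | no i≢j = s-clique (lookup⇒[]= i s i∈s) (lookup⇒[]= j s j∈s) i≢j
    ... | true  | true  | yes _  = refl
    ... | true  | false | _      = refl
    ... | false | _     | _      = refl

maxList-map-lub : ∀ {A : Set} (F : A → ℕ) (xs : List A) {b : ℕ} → (∀ x → F x ≤ b) → maxList (List.map F xs) ≤ b
maxList-map-lub F []       _     = z≤n
maxList-map-lub F (x ∷ xs) F≤b = ⊔-lub (F≤b x) (maxList-map-lub F xs F≤b)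

≤-maxList-map : ∀ {A : Set} (F : A → ℕ) {xs : List A} {x : A} → x List.∈ xs → F x ≤ maxList (List.map F xs)
≤-maxList-map F         (here refl)  = m≤m⊔n _ _
≤-maxList-map F {y ∷ _} (there x∈xs) = ≤-trans (≤-maxList-map F x∈xs) (m≤n⊔m (F y) _)

∈-allSubsets : (s : Subset m) → s List.∈ allSubsets m
∈-allSubsets []            = here refl
∈-allSubsets (inside ∷ s)  = ∈-++⁺ˡ (∈-map⁺ (inside ∷_) (∈-allSubsets s))
∈-allSubsets (outside ∷ s) = ∈-++⁺ʳ _ (∈-map⁺ (outside ∷_) (∈-allSubsets s))

-- α G and ω G are, definitionally, largest (isIndependent G) and largest (isClique G).
largest : (Subset m → Bool) → ℕ
largest {m} P = maxList (List.map (λ s → if P s then ∣ s ∣ else 0) (allSubsets m))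

largest-lub : {P : Subset m → Bool} {b : ℕ} → (∀ s → P s ≡ true → ∣ s ∣ ≤ b) → largest P ≤ b
largest-lub {m} {P} bound = maxList-map-lub _ (allSubsets m) size≤b
  where
  size≤b : ∀ s → (if P s then ∣ s ∣ else 0) ≤ _
  size≤b s with P s in Ps
  ... | true  = bound s Ps
  ... | false = z≤n

≤-largest : {P : Subset m → Bool} (s : Subset m) → P s ≡ true → ∣ s ∣ ≤ largest P
≤-largest {P = P} s Ps = subst (_≤ largest P) (cong (λ b → if b then ∣ s ∣ else 0) Ps)
  (≤-maxList-map (λ s → if P s then ∣ s ∣ else 0) (∈-allSubsets s))

ω≤1+ω[─V] : (H : Graph) (s : Subset (n H)) → Independent H s → ω H ≤ suc (ω (H ─V s))
ω≤1+ω[─V] H s s-independent =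
  largest-lub {P = isClique H} λ k k-clique → bound k (isClique⇒Clique {G = H} k-clique)
  where
  open ≤-Reasoning
  bound : ∀ k → Clique H k → ∣ k ∣ ≤ suc (ω (H ─V s))
  bound k k-clique = begin
    ∣ k ∣                         ≤⟨ p⊆q⇒∣p∣≤∣q∣ split ⟩
    ∣ k ∩ s ∪ k ∩ ∁ s ∣           ≡⟨ ∣p∪q∣≡∣p∣+∣q∣ disjoint ⟩
    ∣ k ∩ s ∣ + ∣ k ∩ ∁ s ∣       ≤⟨ +-mono-≤ (Clique∩Independent⇒∣∣≤1 H k-clique s-independent) ∣k∩∁s∣≤ω ⟩
    suc (ω (H ─V s))              ∎
    where
    split : k ⊆ k ∩ s ∪ k ∩ ∁ s
    split {x} x∈k with x ∈? s
    ... | yes x∈s = x∈p∪q⁺ (inj₁ (x∈p∩q⁺ (x∈k , x∈s)))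
    ... | no  x∉s = x∈p∪q⁺ (inj₂ (x∈p∩q⁺ (x∈k , x∉p⇒x∈∁p x∉s)))
    disjoint : ∀ {x} → x ∈ k ∩ s → x ∉ k ∩ ∁ s
    disjoint x∈ x∈′ = x∈∁p⇒x∉p (proj₂ (x∈p∩q⁻ k _ x∈′)) (proj₂ (x∈p∩q⁻ k s x∈))
    rest-clique : Clique H (k ∩ ∁ s)
    rest-clique x∈ y∈ = k-clique (proj₁ (x∈p∩q⁻ k _ x∈)) (proj₁ (x∈p∩q⁻ k _ y∈))
    ∣k∩∁s∣≤ω : ∣ k ∩ ∁ s ∣ ≤ ω (H ─V s)
    ∣k∩∁s∣≤ω = subst (_≤ ω (H ─V s)) (∣preimage-ι∣≡∣q∣ (p∩q⊆q k (∁ s)))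
      (≤-largest {P = isClique (H ─V s)} (preimage (ι (∁ s)) (k ∩ ∁ s))
        (Clique⇒isClique {G = H ─V s} (Clique-preimage H (∁ s) rest-clique)))

∣V[induced]∣≤∣V∣ : (G : Graph) (p : Subset (n G)) → ∣V∣ (induced G p) ≤ ∣V∣ G
∣V[induced]∣≤∣V∣ G p = subst (_≤ n G) (sym (∣verts∣≡∣p∣ p)) (∣p∣≤n p)

module MinimumModulatorReduction
  (ρ : Graph → ℤ) (ρ-invariant : IsGraphParameter ρ) (c : ℤ)
  (G : Graph) (S : Subset (n G)) (S-minimum : IsMinModulator ρ c G S)
  (I : Subset (length (verts S))) (I-independent : Independent (induced G S) I)
  where

  -- X = V(G) ∖ (S ∖ I), and J is I as a vertex set of G[X].
  Ī : Subset (n G)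
  Ī = image (ι S) I

  X : Subset (n G)
  X = ∁ S ∪ Ī

  J : Subset (length (verts X))
  J = preimage (ι X) Ī

  Ī⊆S : Ī ⊆ S
  Ī⊆S x∈ with ∈image⁻ x∈
  ... | i , _ , refl = ι∈ S i

  Ī⊆X : Ī ⊆ X
  Ī⊆X = q⊆p∪q (∁ S) Ī

  lift-J : lift X J ≡ S
  lift-J = begin
    ∁ X ∪ image (ι X) J  ≡⟨ cong (∁ X ∪_) (image-ι-preimage Ī⊆X) ⟩
    ∁ X ∪ Ī              ≡⟨ ∁[∁p∪q]∪q≡p Ī⊆S ⟩
    S                    ∎
    where open ≡-Reasoning

  ρ[G[X]─V]≡ρ[G─Vlift] : ∀ T → ρ (induced G X ─V T) ≡ ρ (G ─V lift X T)
  ρ[G[X]─V]≡ρ[G─Vlift] T = ρ-invariant _ _ (induced-─V-lift G X T)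

  J-modulator : IsModulator ρ c (induced G X) J
  J-modulator = subst (ℤ._≤ c) (sym (trans (ρ[G[X]─V]≡ρ[G─Vlift] J) (cong (ρ ∘ (G ─V_)) lift-J)))
                      (proj₁ S-minimum)

  J-minimum : IsMinModulator ρ c (induced G X) J
  J-minimum = J-modulator , λ T T-modulator → +-cancelˡ-≤ ∣ ∁ X ∣ _ _ (begin
    ∣ ∁ X ∣ + ∣ J ∣  ≡⟨ ∣lift∣≡∣∁p∣+∣b∣ X J ⟨
    ∣ lift X J ∣     ≡⟨ cong ∣_∣ lift-J ⟩
    ∣ S ∣            ≤⟨ proj₂ S-minimum (lift X T) (subst (ℤ._≤ c) (ρ[G[X]─V]≡ρ[G─Vlift] T) T-modulator) ⟩
    ∣ lift X T ∣     ≡⟨ ∣lift∣≡∣∁p∣+∣b∣ X T ⟩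
    ∣ ∁ X ∣ + ∣ T ∣  ∎)
    where open ≤-Reasoning

  J-independent : Independent (induced G X) J
  J-independent = Independent-preimage G X (Independent-image G S I-independent)

  ∣I∣≡∣J∣ : ∣ I ∣ ≡ ∣ J ∣
  ∣I∣≡∣J∣ = trans (sym (∣image∣≡∣p∣ (ι-injective S) I)) (sym (∣preimage-ι∣≡∣q∣ Ī⊆X))

lemma5p5 : (ρ : Graph → ℤ) → IsGraphParameter ρ →
    (g : ℕ → ℕ) → Nondecreasing g → (c : ℤ) →
    (𝒢 : Graph → Set) → IsHereditary 𝒢 →
    (f : ℕ → ℕ) → Nondecreasing f →
    (∀ G → 𝒢 G → μ≤ ρ c G (f (ω G) * g (∣V∣ G))) →
    (h : ℤ → ℕ) → NondecreasingZ h → (∀ G → ω G ≤ h (ρ G)) →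
    ∀ G → 𝒢 G → (S : Subset (∣V∣ G)) → IsMinModulator ρ c G S →
    α (induced G S) ≤ f (h c + 1) * g (∣V∣ G)
lemma5p5 ρ ρ-invariant g g-mono c 𝒢 (_ , 𝒢-induced) f f-mono μ-bound h h-mono ω≤h G G∈𝒢 S S-minimum =
  largest-lub {P = isIndependent (induced G S)} λ I I-independent →
    independent-size-bound I (isIndependent⇒Independent {G = induced G S} I-independent)
  where
  open ≤-Reasoning
  independent-size-bound : ∀ I → Independent (induced G S) I → ∣ I ∣ ≤ f (h c + 1) * g (∣V∣ G)
  independent-size-bound I I-independent = begin
    ∣ I ∣                                         ≡⟨ ∣I∣≡∣J∣ ⟩
    ∣ J ∣                                         ≤⟨ μ-bound (induced G X) (𝒢-induced G X G∈𝒢) J J-minimum ⟩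
    f (ω (induced G X)) * g (∣V∣ (induced G X))  ≤⟨ *-mono-≤ (f-mono ω[G[X]]≤) (g-mono (∣V[induced]∣≤∣V∣ G X)) ⟩
    f (h c + 1) * g (∣V∣ G)                       ∎
    where
    open MinimumModulatorReduction ρ ρ-invariant c G S S-minimum I I-independent
    ω[G[X]]≤ : ω (induced G X) ≤ h c + 1
    ω[G[X]]≤ = begin
      ω (induced G X)                   ≤⟨ ω≤1+ω[─V] (induced G X) J J-independent ⟩
      suc (ω (induced G X ─V J))        ≤⟨ s≤s (ω≤h _) ⟩
      suc (h (ρ (induced G X ─V J)))    ≤⟨ s≤s (h-mono J-modulator) ⟩
      suc (h c)                         ≡⟨ +-comm 1 (h c) ⟩
      h c + 1                           ∎
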